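{- Let $H_1$ and $H_2$ be vertex-disjoint $i$-graph realizable graphs, and let $x\in V(H_1)$ and $y\in V(H_2)$. Then the graph $H_{xy}$ obtained from $H_1\cup H_2$ by adding the edge $xy$ is $i$-graph realizable.
   Context: All graphs are finite and simple. For a graph $G$, $i(G)$ denotes the minimum cardinality of an independent dominating set of $G$; an independent dominating set of cardinality $i(G)$ is an $i$-set of $G$. The $i$-graph $\mathcal{I}(G)$ of $G$ is the graph whose vertices are the $i$-sets of $G$, where two $i$-sets $S$ and $S'$ are adjacent if and only if there is an edge $xy\in E(G)$ with $S'=(S-\{x\})\cup\{y\}$. A graph $H$ is $i$-graph realizable (an $i$-graph) if there exists a graph $G$ with $\mathcal{I}(G)\cong H$. -}

module Defs where

open import Data.Nat using (ℕ; _+_; _≤_)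
open import Data.Bool using (Bool; true; false; _∧_; if_then_else_)
open import Data.Fin using (Fin; splitAt; _≟_)
open import Data.Fin.Subset using (Subset; _∈_; _∉_; ∣_∣; _∪_; _-_; ⁅_⁆)
open import Data.Sum using (_⊎_; inj₁; inj₂)
open import Data.Product using (Σ; ∃; _×_; _,_)
open import Relation.Binary.PropositionalEquality using (_≡_)
open import Relation.Nullary.Decidable using (⌊_⌋)
open import Function.Definitions using (Injective)
open import Function.Bundles using (_⇔_)

record Graph : Set where
  field
    n   : ℕ
    adj : Fin n → Fin n → Bool
open Graph public

IsSimple : Graph → Set
IsSimple G = (∀ u v → adj G u v ≡ adj G v u) × (∀ v → adj G v v ≡ false)

Independent : (G : Graph) → Subset (n G) → Set
Independent G S = ∀ u v → u ∈ S → v ∈ S → adj G u v ≡ false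

Dominating : (G : Graph) → Subset (n G) → Set
Dominating G S = ∀ v → v ∈ S ⊎ ∃ λ u → u ∈ S × adj G u v ≡ true

IsIDS : (G : Graph) → Subset (n G) → Set
IsIDS G S = Independent G S × Dominating G S

IsISet : (G : Graph) → Subset (n G) → Set
IsISet G S = IsIDS G S × (∀ T → IsIDS G T → ∣ S ∣ ≤ ∣ T ∣)

IAdj : (G : Graph) → Subset (n G) → Subset (n G) → Set
IAdj G S S' = ∃ λ x → ∃ λ y → adj G x y ≡ true × x ∈ S × y ∉ S × S' ≡ (S - x) ∪ ⁅ y ⁆

IsoToIGraph : Graph → Graph → Set
IsoToIGraph H G =
  Σ (Fin (n H) → Subset (n G)) λ f →
    (∀ a → IsISet G (f a)) ×
    Injective _≡_ _≡_ f ×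
    (∀ S → IsISet G S → ∃ λ a → f a ≡ S) ×
    (∀ a b → (adj H a b ≡ true) ⇔ IAdj G (f a) (f b))

IGraphRealizable : Graph → Set
IGraphRealizable H = ∃ λ G → IsSimple G × IsoToIGraph H G

joinEdge : (H₁ H₂ : Graph) → Fin (n H₁) → Fin (n H₂) → Graph
joinEdge H₁ H₂ x y = record { n = n H₁ + n H₂ ; adj = a }
  where
  a : Fin (n H₁ + n H₂) → Fin (n H₁ + n H₂) → Bool
  a u v with splitAt (n H₁) u | splitAt (n H₁) v
  ... | inj₁ u₁ | inj₁ v₁ = adj H₁ u₁ v₁
  ... | inj₂ u₂ | inj₂ v₂ = adj H₂ u₂ v₂
  ... | inj₁ u₁ | inj₂ v₂ = ⌊ u₁ ≟ x ⌋ ∧ ⌊ v₂ ≟ y ⌋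
  ... | inj₂ u₂ | inj₁ v₁ = ⌊ v₁ ≟ x ⌋ ∧ ⌊ u₂ ≟ y ⌋

{-# OPTIONS --safe #-}

-- Let X and Y be the i-sets of G₁ and G₂ that realise x and y. The realising graph G is
-- G₁ ⊔ G₂ plus a gadget hub₁, hub₂, twin₁, twin₂ spanning K₄ minus the edge twin₁twin₂, where hub₁
-- is also joined to V(G₁) − X and hub₂ to V(G₂) − Y. An independent dominating set meets the gadget
-- in {hub₁}, {hub₂} or {twin₁, twin₂}, since each twin must be dominated by itself or by a hub. A
-- chosen hub pins its own side: the set cannot contain the hub's neighbours there, and the vertices
-- of X (resp. Y) can then only be dominated by themselves. So the i-sets of G are P ∪ Y ∪ {hub₂} and
-- X ∪ Q ∪ {hub₁} for i-sets P of G₁ and Q of G₂, all of size i(G₁) + i(G₂) + 1, while sets containing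
-- the twins are one larger. Swaps within one family are swaps in G₁ or in G₂, and the only swap
-- between the two families is hub₂ ↦ hub₁ from X ∪ Y ∪ {hub₂} to X ∪ Y ∪ {hub₁}: the new edge xy.

module Submission where

open import Defs
open import Data.Bool using (Bool; true; false; not; _∧_)
open import Data.Bool.Properties using (not-injective) renaming (_≟_ to _≟ᴮ_)
open import Data.Empty using (⊥-elim)
open import Data.Fin using (Fin; zero; suc; splitAt; join; _↑ˡ_; _↑ʳ_; _≟_)
open import Data.Fin.Patterns using (0F; 1F; 2F; 3F)
open import Data.Fin.Properties
  using (splitAt-↑ˡ; splitAt-↑ʳ; splitAt-join; join-splitAt; splitAt⁻¹-↑ˡ; splitAt⁻¹-↑ʳ; all?; any?)
open import Data.Fin.Subset using (Subset; _∈_; _∉_; ∣_∣; _∪_; _─_; _-_; ⁅_⁆; ⊥; inside; outside)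
open import Data.Fin.Subset.Properties
  using ( x∈⁅x⁆; x∈⁅y⁆⇒x≡y; x≢y⇒x∉⁅y⁆; x∈p∪q⁺; x∈p∪q⁻; x∈p∧x≢y⇒x∈p-y; p─q⊆p; p─⊥≡p
        ; ∪-identityˡ; ∪-identityʳ)
open import Data.Nat using (ℕ; zero; suc; _+_; _≤_; z≤n; s≤s)
open import Data.Nat.Properties
  using (≤-trans; ≤-reflexive; +-mono-≤; +-monoˡ-≤; +-monoʳ-≤; +-cancelˡ-≤; +-cancelʳ-≤; module ≤-Reasoning)
open import Data.Product using (∃; _×_; _,_; proj₁; proj₂)
import Data.Product as Product
open import Data.Sum using (_⊎_; inj₁; inj₂; [_,_]′)
import Data.Sum as Sum
open import Data.Vec using ([]; _∷_; lookup; _++_; here; there)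
import Data.Vec as Vec
open import Data.Vec.Properties
  using ( []=⇒lookup; lookup⇒[]=; zipWith-++; ++-injectiveˡ; ++-injectiveʳ; tabulate∘lookup; tabulate-cong
        ; lookup-splitAt)
open import Function using (_∘_)
open import Function.Definitions using (Injective)
open import Function.Bundles using (_⇔_; mk⇔; Equivalence)
open import Function.Properties.Equivalence using () renaming (trans to ⇔-trans; sym to ⇔-sym)
open import Relation.Binary.PropositionalEquality
open import Relation.Nullary using (¬_; Dec; yes; no)
open import Relation.Nullary.Decidable using (⌊_⌋; toWitness; _×-dec_; _⊎-dec_; _→-dec_)

private variable m k : ℕ

-- Subsets of Fin (m + k) and swaps

∣++∣ : (P : Subset m) (R : Subset k) → ∣ P ++ R ∣ ≡ ∣ P ∣ + ∣ R ∣
∣++∣ [] R = refl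
∣++∣ (true ∷ P) R = cong suc (∣++∣ P R)
∣++∣ (false ∷ P) R = ∣++∣ P R

∈-++⁺ˡ : {P : Subset m} {R : Subset k} {i : Fin m} → i ∈ P → i ↑ˡ k ∈ P ++ R
∈-++⁺ˡ here = here
∈-++⁺ˡ (there i∈P) = there (∈-++⁺ˡ i∈P)

∈-++⁻ˡ : (P : Subset m) {R : Subset k} {i : Fin m} → i ↑ˡ k ∈ P ++ R → i ∈ P
∈-++⁻ˡ (_ ∷ P) {i = zero} here = here
∈-++⁻ˡ (_ ∷ P) {i = suc i} (there i∈) = there (∈-++⁻ˡ P i∈)

∈-++⁺ʳ : (P : Subset m) {R : Subset k} {j : Fin k} → j ∈ R → m ↑ʳ j ∈ P ++ R
∈-++⁺ʳ [] j∈R = j∈R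
∈-++⁺ʳ (_ ∷ P) j∈R = there (∈-++⁺ʳ P j∈R)

∈-++⁻ʳ : (P : Subset m) {R : Subset k} {j : Fin k} → m ↑ʳ j ∈ P ++ R → j ∈ R
∈-++⁻ʳ [] j∈ = j∈
∈-++⁻ʳ (_ ∷ P) (there j∈) = ∈-++⁻ʳ P j∈

⊥-++ : ∀ m {k} → ⊥ {m + k} ≡ ⊥ {m} ++ ⊥ {k}
⊥-++ zero = refl
⊥-++ (suc m) = cong (outside ∷_) (⊥-++ m)

⁅⁆-↑ˡ : ∀ {m} k (i : Fin m) → ⁅ i ↑ˡ k ⁆ ≡ ⁅ i ⁆ ++ ⊥ {k}
⁅⁆-↑ˡ k (zero {m}) = cong (inside ∷_) (⊥-++ m)
⁅⁆-↑ˡ k (suc i) = cong (outside ∷_) (⁅⁆-↑ˡ k i)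

⁅⁆-↑ʳ : ∀ m {k} (j : Fin k) → ⁅ m ↑ʳ j ⁆ ≡ ⊥ {m} ++ ⁅ j ⁆
⁅⁆-↑ʳ zero j = refl
⁅⁆-↑ʳ (suc m) j = cong (outside ∷_) (⁅⁆-↑ʳ m j)

swap-++ˡ : ∀ {m k} (P : Subset m) (R : Subset k) (u v : Fin m) →
           ((P ++ R) - (u ↑ˡ k)) ∪ ⁅ v ↑ˡ k ⁆ ≡ ((P - u) ∪ ⁅ v ⁆) ++ R
swap-++ˡ {k = k} P R u v = begin
  ((P ++ R) ─ ⁅ u ↑ˡ k ⁆) ∪ ⁅ v ↑ˡ k ⁆
    ≡⟨ cong₂ (λ U W → ((P ++ R) ─ U) ∪ W) (⁅⁆-↑ˡ k u) (⁅⁆-↑ˡ k v) ⟩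
  ((P ++ R) ─ (⁅ u ⁆ ++ ⊥)) ∪ (⁅ v ⁆ ++ ⊥)
    ≡⟨ cong (_∪ (⁅ v ⁆ ++ ⊥)) (zipWith-++ _ P R ⁅ u ⁆ ⊥) ⟩
  ((P - u) ++ (R ─ ⊥)) ∪ (⁅ v ⁆ ++ ⊥)
    ≡⟨ zipWith-++ _ (P - u) (R ─ ⊥) ⁅ v ⁆ ⊥ ⟩
  ((P - u) ∪ ⁅ v ⁆) ++ ((R ─ ⊥) ∪ ⊥)
    ≡⟨ cong (((P - u) ∪ ⁅ v ⁆) ++_) (trans (∪-identityʳ (R ─ ⊥)) (p─⊥≡p R)) ⟩
  ((P - u) ∪ ⁅ v ⁆) ++ R ∎
  where open ≡-Reasoning

swap-++ʳ : ∀ {m k} (P : Subset m) (R : Subset k) (u v : Fin k) →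
           ((P ++ R) - (m ↑ʳ u)) ∪ ⁅ m ↑ʳ v ⁆ ≡ P ++ ((R - u) ∪ ⁅ v ⁆)
swap-++ʳ {m} P R u v = begin
  ((P ++ R) ─ ⁅ m ↑ʳ u ⁆) ∪ ⁅ m ↑ʳ v ⁆
    ≡⟨ cong₂ (λ U W → ((P ++ R) ─ U) ∪ W) (⁅⁆-↑ʳ m u) (⁅⁆-↑ʳ m v) ⟩
  ((P ++ R) ─ (⊥ ++ ⁅ u ⁆)) ∪ (⊥ ++ ⁅ v ⁆)
    ≡⟨ cong (_∪ (⊥ ++ ⁅ v ⁆)) (zipWith-++ _ P R ⊥ ⁅ u ⁆) ⟩
  ((P ─ ⊥) ++ (R - u)) ∪ (⊥ ++ ⁅ v ⁆)
    ≡⟨ zipWith-++ _ (P ─ ⊥) (R - u) ⊥ ⁅ v ⁆ ⟩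
  ((P ─ ⊥) ∪ ⊥) ++ ((R - u) ∪ ⁅ v ⁆)
    ≡⟨ cong (_++ ((R - u) ∪ ⁅ v ⁆)) (trans (∪-identityʳ (P ─ ⊥)) (p─⊥≡p P)) ⟩
  P ++ ((R - u) ∪ ⁅ v ⁆) ∎
  where open ≡-Reasoning

lookup-extensionality : {P Q : Subset m} → (∀ i → lookup P i ≡ lookup Q i) → P ≡ Q
lookup-extensionality {P = P} {Q} P≗Q =
  trans (sym (tabulate∘lookup P)) (trans (tabulate-cong P≗Q) (tabulate∘lookup Q))

⁅x⁆-x≡⊥ : (x : Fin m) → ⁅ x ⁆ - x ≡ ⊥
⁅x⁆-x≡⊥ zero = cong (outside ∷_) (p─⊥≡p ⊥)
⁅x⁆-x≡⊥ (suc x) = cong (outside ∷_) (⁅x⁆-x≡⊥ x)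

∣P++Q++R∣ : ∀ {m k l} (P : Subset m) (Q : Subset k) (R : Subset l) →
            ∣ P ++ (Q ++ R) ∣ ≡ ∣ P ∣ + (∣ Q ∣ + ∣ R ∣)
∣P++Q++R∣ P Q R = trans (∣++∣ P (Q ++ R)) (cong (∣ P ∣ +_) (∣++∣ Q R))

x∉p-x : (p : Subset m) (x : Fin m) → x ∉ p - x
x∉p-x (_ ∷ p) zero ()
x∉p-x (_ ∷ p) (suc x) (there x∈) = x∉p-x p x x∈

module _ {S : Subset m} {u v : Fin m} where

  swap-∈ : v ∈ (S - u) ∪ ⁅ v ⁆
  swap-∈ = x∈p∪q⁺ (inj₂ (x∈⁅x⁆ v))

  swap-∉ : u ∈ S → v ∉ S → u ∉ (S - u) ∪ ⁅ v ⁆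
  swap-∉ u∈S v∉S u∈ with x∈p∪q⁻ (S - u) ⁅ v ⁆ u∈
  ... | inj₁ u∈S-u = x∉p-x S u u∈S-u
  ... | inj₂ u∈⁅v⁆ = v∉S (subst (_∈ S) (x∈⁅y⁆⇒x≡y v u∈⁅v⁆) u∈S)

  swap-lost⇒≡ : ∀ {z} → z ∈ S → z ∉ (S - u) ∪ ⁅ v ⁆ → z ≡ u
  swap-lost⇒≡ {z} z∈S z∉ with z ≟ u
  ... | yes z≡u = z≡u
  ... | no z≢u = ⊥-elim (z∉ (x∈p∪q⁺ (inj₁ (x∈p∧x≢y⇒x∈p-y z∈S z≢u))))

  swap-gained⇒≡ : ∀ {z} → z ∉ S → z ∈ (S - u) ∪ ⁅ v ⁆ → z ≡ v
  swap-gained⇒≡ z∉S z∈ with x∈p∪q⁻ (S - u) ⁅ v ⁆ z∈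
  ... | inj₁ z∈S-u = ⊥-elim (z∉S (p─q⊆p S ⁅ u ⁆ z∈S-u))
  ... | inj₂ z∈⁅v⁆ = x∈⁅y⁆⇒x≡y v z∈⁅v⁆

IAdj⇒swap-at : (G : Graph) {S S′ : Subset (n G)} {z w : Fin (n G)} → IAdj G S S′ →
               z ∈ S → z ∉ S′ → w ∉ S → w ∈ S′ → S′ ≡ (S - z) ∪ ⁅ w ⁆
IAdj⇒swap-at G {S} (u , v , _ , _ , _ , refl) z∈S z∉S′ w∉S w∈S′ =
  cong₂ (λ a b → (S - a) ∪ ⁅ b ⁆) (sym (swap-lost⇒≡ z∈S z∉S′)) (sym (swap-gained⇒≡ w∉S w∈S′))

↑ˡ-if-changed : (P P′ : Subset m) (R : Subset k) (z : Fin (m + k)) →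
                z ∈ P ++ R → z ∉ P′ ++ R → ∃ λ i → i ↑ˡ k ≡ z
↑ˡ-if-changed {m} P P′ R z z∈ z∉ with splitAt m z in eq
... | inj₁ i = i , splitAt⁻¹-↑ˡ eq
... | inj₂ j with refl ← splitAt⁻¹-↑ʳ eq = ⊥-elim (z∉ (∈-++⁺ʳ P′ (∈-++⁻ʳ P z∈)))

↑ʳ-if-changed : (L : Subset m) (Q Q′ : Subset k) (z : Fin (m + k)) →
                z ∈ L ++ Q → z ∉ L ++ Q′ → ∃ λ j → m ↑ʳ j ≡ z
↑ʳ-if-changed {m} L Q Q′ z z∈ z∉ with splitAt m z in eq
... | inj₂ j = j , splitAt⁻¹-↑ʳ eq
... | inj₁ i with refl ← splitAt⁻¹-↑ˡ eq = ⊥-elim (z∉ (∈-++⁺ˡ (∈-++⁻ˡ L z∈)))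

IAdj-++ˡ : (G₁ : Graph) (E : Fin (n G₁ + k) → Fin (n G₁ + k) → Bool) →
           (∀ i j → E (i ↑ˡ k) (j ↑ˡ k) ≡ adj G₁ i j) → (R : Subset k) {P P′ : Subset (n G₁)} →
           IAdj G₁ P P′ ⇔ IAdj (record { n = n G₁ + k ; adj = E }) (P ++ R) (P′ ++ R)
IAdj-++ˡ G₁ E E-↑ˡ R {P} {P′} = mk⇔ to from
  where
  to : IAdj G₁ P P′ → IAdj _ (P ++ R) (P′ ++ R)
  to (u , v , e , u∈ , v∉ , refl) =
    u ↑ˡ _ , v ↑ˡ _ , trans (E-↑ˡ u v) e , ∈-++⁺ˡ u∈ , v∉ ∘ ∈-++⁻ˡ P , sym (swap-++ˡ P R u v)
  from : IAdj _ (P ++ R) (P′ ++ R) → IAdj G₁ P P′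
  from (u , v , e , u∈ , v∉ , eq)
    with (i , refl) ← ↑ˡ-if-changed P P′ R u u∈ (subst (u ∉_) (sym eq) (swap-∉ u∈ v∉))
       | (j , refl) ← ↑ˡ-if-changed P′ P R v (subst (v ∈_) (sym eq) swap-∈) v∉
    = i , j , trans (sym (E-↑ˡ i j)) e , ∈-++⁻ˡ P u∈ , v∉ ∘ ∈-++⁺ˡ ,
      ++-injectiveˡ P′ _ (trans eq (swap-++ˡ P R i j))

IAdj-++ʳ : (G₂ : Graph) (E : Fin (m + n G₂) → Fin (m + n G₂) → Bool) →
           (∀ i j → E (m ↑ʳ i) (m ↑ʳ j) ≡ adj G₂ i j) → (L : Subset m) {Q Q′ : Subset (n G₂)} →
           IAdj G₂ Q Q′ ⇔ IAdj (record { n = m + n G₂ ; adj = E }) (L ++ Q) (L ++ Q′)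
IAdj-++ʳ {m} G₂ E E-↑ʳ L {Q} {Q′} = mk⇔ to from
  where
  to : IAdj G₂ Q Q′ → IAdj _ (L ++ Q) (L ++ Q′)
  to (u , v , e , u∈ , v∉ , refl) =
    m ↑ʳ u , m ↑ʳ v , trans (E-↑ʳ u v) e , ∈-++⁺ʳ L u∈ , v∉ ∘ ∈-++⁻ʳ L , sym (swap-++ʳ L Q u v)
  from : IAdj _ (L ++ Q) (L ++ Q′) → IAdj G₂ Q Q′
  from (u , v , e , u∈ , v∉ , eq)
    with (i , refl) ← ↑ʳ-if-changed L Q Q′ u u∈ (subst (u ∉_) (sym eq) (swap-∉ u∈ v∉))
       | (j , refl) ← ↑ʳ-if-changed L Q′ Q v (subst (v ∈_) (sym eq) swap-∈) v∉
    = i , j , trans (sym (E-↑ʳ i j)) e , ∈-++⁻ʳ L u∈ , v∉ ∘ ∈-++⁺ʳ L ,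
      ++-injectiveʳ L L (trans eq (swap-++ʳ L Q i j))

true≢false : true ≢ false
true≢false ()

bool-ext : {a b : Bool} → (a ≡ true → b ≡ true) → (b ≡ true → a ≡ true) → a ≡ b
bool-ext {true} a⇒b _ = sym (a⇒b refl)
bool-ext {false} {true} _ b⇒a = b⇒a refl
bool-ext {false} {false} _ _ = refl

-- Independent domination for a characteristic function M on an arbitrary vertex type, so that the
-- graph constructed below can be analysed on V(G₁) ⊎ V(G₂) ⊎ Fin 4 rather than on Fin N.
module _ {V : Set} (E : V → V → Bool) (M : V → Bool) where

  Independentᵇ : Set
  Independentᵇ = ∀ u v → M u ≡ true → M v ≡ true → E u v ≡ false

  Dominatesᵇ : V → Set
  Dominatesᵇ v = M v ≡ true ⊎ ∃ λ u → M u ≡ true × E u v ≡ true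

  IsIDSᵇ : Set
  IsIDSᵇ = Independentᵇ × (∀ v → Dominatesᵇ v)

IsIDS⇔IsIDSᵇ : (G : Graph) {S : Subset (n G)} {M : Fin (n G) → Bool} →
               (∀ u → lookup S u ≡ M u) → IsIDS G S ⇔ IsIDSᵇ (adj G) M
IsIDS⇔IsIDSᵇ G {S} {M} S≗M = mk⇔ to from
  where
  ∈⇒M : ∀ {u} → u ∈ S → M u ≡ true
  ∈⇒M u∈S = trans (sym (S≗M _)) ([]=⇒lookup u∈S)
  M⇒∈ : ∀ {u} → M u ≡ true → u ∈ S
  M⇒∈ {u} Mu = lookup⇒[]= u S (trans (S≗M u) Mu)
  to : IsIDS G S → IsIDSᵇ (adj G) M
  to (ind , dom) = (λ u v Mu Mv → ind u v (M⇒∈ Mu) (M⇒∈ Mv))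
                 , λ v → Sum.map ∈⇒M (Product.map₂ (Product.map₁ ∈⇒M)) (dom v)
  from : IsIDSᵇ (adj G) M → IsIDS G S
  from (ind , dom) = (λ u v u∈S v∈S → ind u v (∈⇒M u∈S) (∈⇒M v∈S))
                   , λ v → Sum.map M⇒∈ (Product.map₂ (Product.map₁ M⇒∈)) (dom v)

IsIDS⇔IsIDSᵇ-lookup : (G : Graph) (S : Subset (n G)) → IsIDS G S ⇔ IsIDSᵇ (adj G) (lookup S)
IsIDS⇔IsIDSᵇ-lookup G S = IsIDS⇔IsIDSᵇ G (λ _ → refl)

IsIDSᵇ-pullback : {V W : Set} (E : W → W → Bool) (M : W → Bool) (h : V → W) (s : W → V) →
                  (∀ w → h (s w) ≡ w) → IsIDSᵇ (λ u v → E (h u) (h v)) (M ∘ h) ⇔ IsIDSᵇ E M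
IsIDSᵇ-pullback E M h s hs = mk⇔ to from
  where
  M-hs : ∀ {w} → M w ≡ true → M (h (s w)) ≡ true
  M-hs {w} = subst (λ z → M z ≡ true) (sym (hs w))
  to : IsIDSᵇ (λ u v → E (h u) (h v)) (M ∘ h) → IsIDSᵇ E M
  to (ind , dom) = ind′ , dom′
    where
    ind′ : Independentᵇ E M
    ind′ w w′ Mw Mw′ =
      subst₂ (λ a b → E a b ≡ false) (hs w) (hs w′) (ind (s w) (s w′) (M-hs Mw) (M-hs Mw′))
    dom′ : ∀ w → Dominatesᵇ E M w
    dom′ w with dom (s w)
    ... | inj₁ Mw = inj₁ (subst (λ z → M z ≡ true) (hs w) Mw)
    ... | inj₂ (u , Mu , e) = inj₂ (h u , Mu , subst (λ z → E (h u) z ≡ true) (hs w) e)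
  from : IsIDSᵇ E M → IsIDSᵇ (λ u v → E (h u) (h v)) (M ∘ h)
  from (ind , dom) = (λ u v → ind (h u) (h v)) , dom′
    where
    dom′ : ∀ v → Dominatesᵇ (λ u v → E (h u) (h v)) (M ∘ h) v
    dom′ v with dom (h v)
    ... | inj₁ Mv = inj₁ Mv
    ... | inj₂ (w , Mw , e) = inj₂ (s w , M-hs Mw , subst (λ z → E z (h v) ≡ true) (sym (hs w)) e)

IsIDSᵇ? : (E : Fin k → Fin k → Bool) (M : Fin k → Bool) → Dec (IsIDSᵇ E M)
IsIDSᵇ? E M =
  (all? λ u → all? λ v → (M u ≟ᴮ true) →-dec (M v ≟ᴮ true) →-dec (E u v ≟ᴮ false))
  ×-dec (all? λ v → (M v ≟ᴮ true) ⊎-dec any? λ u → (M u ≟ᴮ true) ×-dec (E u v ≟ᴮ true))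

_⊕⟨_⟩_ : {V₁ V₂ : Set} → (V₁ → V₁ → Bool) → (V₁ → V₂ → Bool) → (V₂ → V₂ → Bool) →
         V₁ ⊎ V₂ → V₁ ⊎ V₂ → Bool
(E₁ ⊕⟨ C ⟩ E₂) (inj₁ u) (inj₁ v) = E₁ u v
(E₁ ⊕⟨ C ⟩ E₂) (inj₁ u) (inj₂ v) = C u v
(E₁ ⊕⟨ C ⟩ E₂) (inj₂ u) (inj₁ v) = C v u
(E₁ ⊕⟨ C ⟩ E₂) (inj₂ u) (inj₂ v) = E₂ u v

module _ {V₁ V₂ : Set} {E₁ : V₁ → V₁ → Bool} {E₂ : V₂ → V₂ → Bool} (C : V₁ → V₂ → Bool) where

  ⊕-symmetric : (∀ u v → E₁ u v ≡ E₁ v u) → (∀ u v → E₂ u v ≡ E₂ v u) →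
                ∀ u v → (E₁ ⊕⟨ C ⟩ E₂) u v ≡ (E₁ ⊕⟨ C ⟩ E₂) v u
  ⊕-symmetric sym₁ sym₂ (inj₁ u) (inj₁ v) = sym₁ u v
  ⊕-symmetric sym₁ sym₂ (inj₁ u) (inj₂ v) = refl
  ⊕-symmetric sym₁ sym₂ (inj₂ u) (inj₁ v) = refl
  ⊕-symmetric sym₁ sym₂ (inj₂ u) (inj₂ v) = sym₂ u v

  ⊕-irreflexive : (∀ u → E₁ u u ≡ false) → (∀ u → E₂ u u ≡ false) → ∀ u → (E₁ ⊕⟨ C ⟩ E₂) u u ≡ false
  ⊕-irreflexive irr₁ irr₂ (inj₁ u) = irr₁ u
  ⊕-irreflexive irr₁ irr₂ (inj₂ u) = irr₂ u

  IsIDSᵇ-⊕ : {M₁ : V₁ → Bool} {M₂ : V₂ → Bool} → IsIDSᵇ E₁ M₁ → IsIDSᵇ E₂ M₂ →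
             (∀ u v → M₁ u ≡ true → M₂ v ≡ true → C u v ≡ false) →
             IsIDSᵇ (E₁ ⊕⟨ C ⟩ E₂) [ M₁ , M₂ ]′
  IsIDSᵇ-⊕ {M₁} {M₂} (ind₁ , dom₁) (ind₂ , dom₂) cross = ind , dom
    where
    ind : Independentᵇ (E₁ ⊕⟨ C ⟩ E₂) [ M₁ , M₂ ]′
    ind (inj₁ u) (inj₁ v) = ind₁ u v
    ind (inj₁ u) (inj₂ v) = cross u v
    ind (inj₂ u) (inj₁ v) Mu Mv = cross v u Mv Mu
    ind (inj₂ u) (inj₂ v) = ind₂ u v
    dom : ∀ v → Dominatesᵇ (E₁ ⊕⟨ C ⟩ E₂) [ M₁ , M₂ ]′ v
    dom (inj₁ v) = Sum.map₂ (λ (u , Mu , e) → inj₁ u , Mu , e) (dom₁ v)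
    dom (inj₂ v) = Sum.map₂ (λ (u , Mu , e) → inj₂ u , Mu , e) (dom₂ v)

module Block {V : Set} (E : V → V → Bool) {M : V → Bool} (M-ids : IsIDSᵇ E M)
  (H : Graph) (ι : Fin (n H) → V) (E-ι : ∀ i j → E (ι i) (ι j) ≡ adj H i j)
  (hub : V) (Z : Subset (n H)) (E-hub : ∀ i → E hub (ι i) ≡ not (lookup Z i))
  (only-hub : ∀ u i → E u (ι i) ≡ true → (∃ λ j → ι j ≡ u) ⊎ hub ≡ u) where

  restricted-IDS : M hub ≡ false → IsIDSᵇ (adj H) (M ∘ ι)
  restricted-IDS Mhub =
    (λ i j Mi Mj → trans (sym (E-ι i j)) (proj₁ M-ids (ι i) (ι j) Mi Mj)) , dom
    where
    dom : ∀ i → Dominatesᵇ (adj H) (M ∘ ι) i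
    dom i with proj₂ M-ids (ι i)
    ... | inj₁ Mi = inj₁ Mi
    ... | inj₂ (u , Mu , e) with only-hub u i e
    ...   | inj₁ (j , refl) = inj₂ (j , Mu , trans (sym (E-ι j i)) e)
    ...   | inj₂ refl = ⊥-elim (true≢false (trans (sym Mu) Mhub))

  -- With the hub chosen, independence keeps M inside Z, and a vertex of Z can be dominated
  -- neither from Z (which is independent) nor by the hub.
  forced : M hub ≡ true → Independentᵇ (adj H) (lookup Z) → ∀ i → M (ι i) ≡ lookup Z i
  forced Mhub Z-ind i = bool-ext (forced⊆ i) (forced⊇ i)
    where
    forced⊆ : ∀ i → M (ι i) ≡ true → lookup Z i ≡ true
    forced⊆ i Mi = not-injective (trans (sym (E-hub i)) (proj₁ M-ids hub (ι i) Mhub Mi))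
    forced⊇ : ∀ i → lookup Z i ≡ true → M (ι i) ≡ true
    forced⊇ i Zi with proj₂ M-ids (ι i)
    ... | inj₁ Mi = Mi
    ... | inj₂ (u , Mu , e) with only-hub u i e
    ...   | inj₁ (j , refl) =
      ⊥-elim (true≢false (trans (sym (trans (sym (E-ι j i)) e)) (Z-ind j i (forced⊆ j Mu) Zi)))
    ...   | inj₂ refl = ⊥-elim (true≢false (trans (sym e) (trans (E-hub i) (cong not Zi))))

-- The gadget and the construction

pattern hub₂ = 0F
pattern hub₁ = 1F
pattern twin₁ = 2F
pattern twin₂ = 3F

gadget : Fin 4 → Fin 4 → Bool
gadget twin₁ twin₂ = false
gadget twin₂ twin₁ = false
gadget g h = not ⌊ g ≟ h ⌋

twins : Subset 4
twins = ⁅ twin₁ ⁆ ∪ ⁅ twin₂ ⁆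

gadget-symmetric : ∀ g h → gadget g h ≡ gadget h g
gadget-symmetric = toWitness {a? = all? λ g → all? λ h → gadget g h ≟ᴮ gadget h g} _

gadget-irreflexive : ∀ g → gadget g g ≡ false
gadget-irreflexive = toWitness {a? = all? λ g → gadget g g ≟ᴮ false} _

⁅hub₂⁆-IDS : IsIDSᵇ gadget (lookup ⁅ hub₂ ⁆)
⁅hub₂⁆-IDS = toWitness {a? = IsIDSᵇ? gadget (lookup ⁅ hub₂ ⁆)} _

⁅hub₁⁆-IDS : IsIDSᵇ gadget (lookup ⁅ hub₁ ⁆)
⁅hub₁⁆-IDS = toWitness {a? = IsIDSᵇ? gadget (lookup ⁅ hub₁ ⁆)} _

gadget-shape : (R : Subset 4) → Independentᵇ gadget (lookup R) →
               (∀ t → lookup R (suc (suc t)) ≡ true ⊎ lookup R hub₂ ≡ true ⊎ lookup R hub₁ ≡ true) →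
               R ≡ ⁅ hub₂ ⁆ ⊎ R ≡ ⁅ hub₁ ⁆ ⊎ R ≡ twins
gadget-shape (true ∷ true ∷ _ ∷ _ ∷ []) ind _ = ⊥-elim (true≢false (ind hub₂ hub₁ refl refl))
gadget-shape (true ∷ false ∷ true ∷ _ ∷ []) ind _ = ⊥-elim (true≢false (ind hub₂ twin₁ refl refl))
gadget-shape (true ∷ false ∷ false ∷ true ∷ []) ind _ = ⊥-elim (true≢false (ind hub₂ twin₂ refl refl))
gadget-shape (true ∷ false ∷ false ∷ false ∷ []) _ _ = inj₁ refl
gadget-shape (false ∷ true ∷ true ∷ _ ∷ []) ind _ = ⊥-elim (true≢false (ind hub₁ twin₁ refl refl))
gadget-shape (false ∷ true ∷ false ∷ true ∷ []) ind _ = ⊥-elim (true≢false (ind hub₁ twin₂ refl refl))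
gadget-shape (false ∷ true ∷ false ∷ false ∷ []) _ _ = inj₂ (inj₁ refl)
gadget-shape (false ∷ false ∷ true ∷ true ∷ []) _ _ = inj₂ (inj₂ refl)
gadget-shape (false ∷ false ∷ false ∷ _ ∷ []) _ twin = [ (λ ()) , [ (λ ()) , (λ ()) ]′ ]′ (twin 0F)
gadget-shape (false ∷ false ∷ true ∷ false ∷ []) _ twin = [ (λ ()) , [ (λ ()) , (λ ()) ]′ ]′ (twin 1F)

module Construction (G₁ G₂ : Graph) (X : Subset (n G₁)) (Y : Subset (n G₂)) where

  toHub₁ : Fin (n G₁) → Fin (n G₂) ⊎ Fin 4 → Bool
  toHub₁ i (inj₂ hub₁) = not (lookup X i)
  toHub₁ i _ = false

  toHub₂ : Fin (n G₂) → Fin 4 → Bool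
  toHub₂ j hub₂ = not (lookup Y j)
  toHub₂ j _ = false

  Vertex : Set
  Vertex = Fin (n G₁) ⊎ (Fin (n G₂) ⊎ Fin 4)

  edge : Vertex → Vertex → Bool
  edge = adj G₁ ⊕⟨ toHub₁ ⟩ (adj G₂ ⊕⟨ toHub₂ ⟩ gadget)

  N : ℕ
  N = n G₁ + (n G₂ + 4)

  view : Fin N → Vertex
  view u = Sum.map₂ (splitAt (n G₂)) (splitAt (n G₁) u)

  unview : Vertex → Fin N
  unview w = join (n G₁) (n G₂ + 4) (Sum.map₂ (join (n G₂) 4) w)

  view∘unview : ∀ w → view (unview w) ≡ w
  view∘unview (inj₁ i) rewrite splitAt-↑ˡ (n G₁) i (n G₂ + 4) = refl
  view∘unview (inj₂ w)
    rewrite splitAt-↑ʳ (n G₁) (n G₂ + 4) (join (n G₂) 4 w) | splitAt-join (n G₂) 4 w = refl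

  G : Graph
  G = record { n = N ; adj = λ u v → edge (view u) (view v) }

  G-simple : IsSimple G₁ → IsSimple G₂ → IsSimple G
  G-simple (sym₁ , irr₁) (sym₂ , irr₂) =
    (λ u v → edge-symmetric (view u) (view v)) , λ u → edge-irreflexive (view u)
    where
    edge-symmetric : ∀ u v → edge u v ≡ edge v u
    edge-symmetric = ⊕-symmetric toHub₁ sym₁ (⊕-symmetric toHub₂ sym₂ gadget-symmetric)
    edge-irreflexive : ∀ u → edge u u ≡ false
    edge-irreflexive = ⊕-irreflexive toHub₁ irr₁ (⊕-irreflexive toHub₂ irr₂ gadget-irreflexive)

  member : Subset (n G₁) → Subset (n G₂) → Subset 4 → Vertex → Bool
  member P Q R = [ lookup P , [ lookup Q , lookup R ]′ ]′

  lookup-view : ∀ P Q R u → lookup (P ++ (Q ++ R)) u ≡ member P Q R (view u)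
  lookup-view P Q R u rewrite lookup-splitAt (n G₁) P (Q ++ R) u with splitAt (n G₁) u
  ... | inj₁ i = refl
  ... | inj₂ r = lookup-splitAt (n G₂) Q R r

  IsIDS⇔member : ∀ P Q R → IsIDS G (P ++ (Q ++ R)) ⇔ IsIDSᵇ edge (member P Q R)
  IsIDS⇔member P Q R = ⇔-trans (IsIDS⇔IsIDSᵇ G (lookup-view P Q R))
                                (IsIDSᵇ-pullback edge (member P Q R) view unview view∘unview)

  A : Subset (n G₁) → Subset N
  A P = P ++ (Y ++ ⁅ hub₂ ⁆)

  B : Subset (n G₂) → Subset N
  B Q = X ++ (Q ++ ⁅ hub₁ ⁆)

  A-injective : ∀ {P P′} → A P ≡ A P′ → P ≡ P′
  A-injective {P} {P′} = ++-injectiveˡ P P′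

  B-injective : ∀ {Q Q′} → B Q ≡ B Q′ → Q ≡ Q′
  B-injective {Q} {Q′} = ++-injectiveˡ Q Q′ ∘ ++-injectiveʳ X X

  A≢B : ∀ {P Q} → A P ≢ B Q
  A≢B {P} {Q} = (λ ()) ∘ ++-injectiveʳ Y Q ∘ ++-injectiveʳ P X

  toHub₁-cross : (P : Subset (n G₁)) (Q : Subset (n G₂)) (R : Subset 4) →
                 (lookup R hub₁ ≡ true → ∀ i → lookup P i ≡ true → lookup X i ≡ true) →
                 ∀ i w → lookup P i ≡ true → [ lookup Q , lookup R ]′ w ≡ true → toHub₁ i w ≡ false
  toHub₁-cross P Q R P⊆X i (inj₁ _) _ _ = refl
  toHub₁-cross P Q R P⊆X i (inj₂ hub₂) _ _ = refl
  toHub₁-cross P Q R P⊆X i (inj₂ hub₁) Pi R∋hub₁ = cong not (P⊆X R∋hub₁ i Pi)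
  toHub₁-cross P Q R P⊆X i (inj₂ twin₁) _ _ = refl
  toHub₁-cross P Q R P⊆X i (inj₂ twin₂) _ _ = refl

  toHub₂-cross : (Q : Subset (n G₂)) (R : Subset 4) →
                 (lookup R hub₂ ≡ true → ∀ j → lookup Q j ≡ true → lookup Y j ≡ true) →
                 ∀ j g → lookup Q j ≡ true → lookup R g ≡ true → toHub₂ j g ≡ false
  toHub₂-cross Q R Q⊆Y j hub₂ Qj R∋hub₂ = cong not (Q⊆Y R∋hub₂ j Qj)
  toHub₂-cross Q R Q⊆Y j hub₁ _ _ = refl
  toHub₂-cross Q R Q⊆Y j twin₁ _ _ = refl
  toHub₂-cross Q R Q⊆Y j twin₂ _ _ = refl

  only-hub₁ : ∀ u i → edge u (inj₁ i) ≡ true → (∃ λ i′ → inj₁ i′ ≡ u) ⊎ inj₂ (inj₂ hub₁) ≡ u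
  only-hub₁ (inj₁ i′) _ _ = inj₁ (i′ , refl)
  only-hub₁ (inj₂ (inj₁ _)) _ ()
  only-hub₁ (inj₂ (inj₂ hub₂)) _ ()
  only-hub₁ (inj₂ (inj₂ hub₁)) _ _ = inj₂ refl
  only-hub₁ (inj₂ (inj₂ twin₁)) _ ()
  only-hub₁ (inj₂ (inj₂ twin₂)) _ ()

  only-hub₂ : ∀ u j → edge u (inj₂ (inj₁ j)) ≡ true →
              (∃ λ j′ → inj₂ (inj₁ j′) ≡ u) ⊎ inj₂ (inj₂ hub₂) ≡ u
  only-hub₂ (inj₁ _) _ ()
  only-hub₂ (inj₂ (inj₁ j′)) _ _ = inj₁ (j′ , refl)
  only-hub₂ (inj₂ (inj₂ hub₂)) _ _ = inj₂ refl
  only-hub₂ (inj₂ (inj₂ hub₁)) _ ()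
  only-hub₂ (inj₂ (inj₂ twin₁)) _ ()
  only-hub₂ (inj₂ (inj₂ twin₂)) _ ()

  twin-dominated : ∀ {M : Vertex → Bool} → IsIDSᵇ edge M → ∀ t →
                   M (inj₂ (inj₂ (suc (suc t)))) ≡ true ⊎
                   M (inj₂ (inj₂ hub₂)) ≡ true ⊎ M (inj₂ (inj₂ hub₁)) ≡ true
  twin-dominated (_ , dom) t with dom (inj₂ (inj₂ (suc (suc t))))
  ... | inj₁ Mt = inj₁ Mt
  ... | inj₂ (inj₂ (inj₂ hub₂) , Mhub₂ , _) = inj₂ (inj₁ Mhub₂)
  ... | inj₂ (inj₂ (inj₂ hub₁) , Mhub₁ , _) = inj₂ (inj₂ Mhub₁)
  twin-dominated _ 0F | inj₂ (inj₂ (inj₂ twin₁) , _ , ())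
  twin-dominated _ 0F | inj₂ (inj₂ (inj₂ twin₂) , _ , ())
  twin-dominated _ 1F | inj₂ (inj₂ (inj₂ twin₁) , _ , ())
  twin-dominated _ 1F | inj₂ (inj₂ (inj₂ twin₂) , _ , ())
  twin-dominated _ _ | inj₂ (inj₁ _ , _ , ())
  twin-dominated _ _ | inj₂ (inj₂ (inj₁ _) , _ , ())

  A-IAdj⇔ : {P P′ : Subset (n G₁)} → IAdj G₁ P P′ ⇔ IAdj G (A P) (A P′)
  A-IAdj⇔ = IAdj-++ˡ G₁ (adj G) (λ i j → cong₂ edge (view∘unview (inj₁ i)) (view∘unview (inj₁ j))) _

  B-IAdj⇔ : {Q Q′ : Subset (n G₂)} → IAdj G₂ Q Q′ ⇔ IAdj G (B Q) (B Q′)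
  B-IAdj⇔ = ⇔-trans
    (IAdj-++ˡ G₂ (λ u v → adj G (n G₁ ↑ʳ u) (n G₁ ↑ʳ v))
      (λ i j → cong₂ edge (view∘unview (inj₂ (inj₁ i))) (view∘unview (inj₂ (inj₁ j)))) _)
    (IAdj-++ʳ (record { n = n G₂ + 4 ; adj = λ u v → adj G (n G₁ ↑ʳ u) (n G₁ ↑ʳ v) })
              (adj G) (λ _ _ → refl) X)

  hub-swap⇔ : (g h : Fin 4) → g ≢ h → gadget g h ≡ true →
              {P P′ : Subset (n G₁)} {Q Q′ : Subset (n G₂)} →
              IAdj G (P ++ (Q ++ ⁅ g ⁆)) (P′ ++ (Q′ ++ ⁅ h ⁆)) ⇔ (P ≡ P′ × Q ≡ Q′)
  hub-swap⇔ g h g≢h gh {P} {P′} {Q} {Q′} = mk⇔ to from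
    where
    γ : Fin 4 → Fin N
    γ g = unview (inj₂ (inj₂ g))
    γ-∈ : (P : Subset (n G₁)) (Q : Subset (n G₂)) {R : Subset 4} {g : Fin 4} →
          g ∈ R → γ g ∈ P ++ (Q ++ R)
    γ-∈ P Q g∈R = ∈-++⁺ʳ P (∈-++⁺ʳ Q g∈R)
    γ-∉ : (P : Subset (n G₁)) (Q : Subset (n G₂)) {R : Subset 4} {g : Fin 4} →
          g ∉ R → γ g ∉ P ++ (Q ++ R)
    γ-∉ P Q g∉R = g∉R ∘ ∈-++⁻ʳ Q ∘ ∈-++⁻ʳ P
    swap-γ : (P : Subset (n G₁)) (Q : Subset (n G₂)) →
             ((P ++ (Q ++ ⁅ g ⁆)) - γ g) ∪ ⁅ γ h ⁆ ≡ P ++ (Q ++ ⁅ h ⁆)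
    swap-γ P Q = begin
      ((P ++ (Q ++ ⁅ g ⁆)) - γ g) ∪ ⁅ γ h ⁆
        ≡⟨ swap-++ʳ P (Q ++ ⁅ g ⁆) (n G₂ ↑ʳ g) (n G₂ ↑ʳ h) ⟩
      P ++ (((Q ++ ⁅ g ⁆) - (n G₂ ↑ʳ g)) ∪ ⁅ n G₂ ↑ʳ h ⁆)
        ≡⟨ cong (P ++_) (swap-++ʳ Q ⁅ g ⁆ g h) ⟩
      P ++ (Q ++ ((⁅ g ⁆ - g) ∪ ⁅ h ⁆))
        ≡⟨ cong (λ S → P ++ (Q ++ (S ∪ ⁅ h ⁆))) (⁅x⁆-x≡⊥ g) ⟩
      P ++ (Q ++ (⊥ ∪ ⁅ h ⁆))
        ≡⟨ cong (λ S → P ++ (Q ++ S)) (∪-identityˡ ⁅ h ⁆) ⟩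
      P ++ (Q ++ ⁅ h ⁆) ∎
      where open ≡-Reasoning
    to : IAdj G (P ++ (Q ++ ⁅ g ⁆)) (P′ ++ (Q′ ++ ⁅ h ⁆)) → P ≡ P′ × Q ≡ Q′
    to P↝P′ = sym (++-injectiveˡ P′ P P′≡P) , sym (++-injectiveˡ Q′ Q (++-injectiveʳ P′ P P′≡P))
      where
      P′≡P : P′ ++ (Q′ ++ ⁅ h ⁆) ≡ P ++ (Q ++ ⁅ h ⁆)
      P′≡P = trans (IAdj⇒swap-at G P↝P′ (γ-∈ P Q (x∈⁅x⁆ g)) (γ-∉ P′ Q′ (x≢y⇒x∉⁅y⁆ g≢h))
                                        (γ-∉ P Q (x≢y⇒x∉⁅y⁆ (g≢h ∘ sym))) (γ-∈ P′ Q′ (x∈⁅x⁆ h)))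
                   (swap-γ P Q)
    from : P ≡ P′ × Q ≡ Q′ → IAdj G (P ++ (Q ++ ⁅ g ⁆)) (P′ ++ (Q′ ++ ⁅ h ⁆))
    from (refl , refl) =
      γ g , γ h , trans (cong₂ edge (view∘unview (inj₂ (inj₂ g))) (view∘unview (inj₂ (inj₂ h)))) gh
      , γ-∈ P Q (x∈⁅x⁆ g) , γ-∉ P Q (x≢y⇒x∉⁅y⁆ (g≢h ∘ sym)) , sym (swap-γ P Q)

  A-B-IAdj⇔ : {P : Subset (n G₁)} {Q : Subset (n G₂)} → IAdj G (A P) (B Q) ⇔ (P ≡ X × Q ≡ Y)
  A-B-IAdj⇔ = ⇔-trans (hub-swap⇔ hub₂ hub₁ (λ ()) refl) (mk⇔ (Product.map₂ sym) (Product.map₂ sym))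

  B-A-IAdj⇔ : {P : Subset (n G₁)} {Q : Subset (n G₂)} → IAdj G (B Q) (A P) ⇔ (P ≡ X × Q ≡ Y)
  B-A-IAdj⇔ = ⇔-trans (hub-swap⇔ hub₁ hub₂ (λ ()) refl) (mk⇔ (Product.map₁ sym) (Product.map₁ sym))

  module Side₁ {M : Vertex → Bool} (ids : IsIDSᵇ edge M) =
    Block edge ids G₁ inj₁ (λ _ _ → refl) (inj₂ (inj₂ hub₁)) X (λ _ → refl) only-hub₁

  module Side₂ {M : Vertex → Bool} (ids : IsIDSᵇ edge M) =
    Block edge ids G₂ (inj₂ ∘ inj₁) (λ _ _ → refl) (inj₂ (inj₂ hub₂)) Y (λ _ → refl) only-hub₂

  module ISets (X-iset : IsISet G₁ X) (Y-iset : IsISet G₂ Y) where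

    private
      X-ids : IsIDS G₁ X
      X-ids = proj₁ X-iset
      Y-ids : IsIDS G₂ Y
      Y-ids = proj₁ Y-iset
      X-idsᵇ : IsIDSᵇ (adj G₁) (lookup X)
      X-idsᵇ = Equivalence.to (IsIDS⇔IsIDSᵇ-lookup G₁ X) X-ids
      Y-idsᵇ : IsIDSᵇ (adj G₂) (lookup Y)
      Y-idsᵇ = Equivalence.to (IsIDS⇔IsIDSᵇ-lookup G₂ Y) Y-ids

    A-IDS : ∀ {P} → IsIDS G₁ P → IsIDS G (A P)
    A-IDS {P} P-ids = Equivalence.from (IsIDS⇔member P Y ⁅ hub₂ ⁆)
      (IsIDSᵇ-⊕ toHub₁ (Equivalence.to (IsIDS⇔IsIDSᵇ-lookup G₁ P) P-ids)
        (IsIDSᵇ-⊕ toHub₂ Y-idsᵇ ⁅hub₂⁆-IDS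
          (toHub₂-cross Y ⁅ hub₂ ⁆ (λ _ _ Yj → Yj)))
        (toHub₁-cross P Y ⁅ hub₂ ⁆ (λ ())))

    B-IDS : ∀ {Q} → IsIDS G₂ Q → IsIDS G (B Q)
    B-IDS {Q} Q-ids = Equivalence.from (IsIDS⇔member X Q ⁅ hub₁ ⁆)
      (IsIDSᵇ-⊕ toHub₁ X-idsᵇ
        (IsIDSᵇ-⊕ toHub₂ (Equivalence.to (IsIDS⇔IsIDSᵇ-lookup G₂ Q) Q-ids) ⁅hub₁⁆-IDS
          (toHub₂-cross Q ⁅ hub₁ ⁆ (λ ())))
        (toHub₁-cross X Q ⁅ hub₁ ⁆ (λ _ _ Xi → Xi)))

    data Shape : Subset N → Set where
      withHub₂  : ∀ {P} → IsIDS G₁ P → Shape (A P)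
      withHub₁  : ∀ {Q} → IsIDS G₂ Q → Shape (B Q)
      withTwins : ∀ {P Q} → IsIDS G₁ P → IsIDS G₂ Q → Shape (P ++ (Q ++ twins))

    restricted₁ : ∀ P Q R → IsIDSᵇ edge (member P Q R) → lookup R hub₁ ≡ false → IsIDS G₁ P
    restricted₁ P _ _ ids = Equivalence.from (IsIDS⇔IsIDSᵇ-lookup G₁ P) ∘ Side₁.restricted-IDS ids

    restricted₂ : ∀ P Q R → IsIDSᵇ edge (member P Q R) → lookup R hub₂ ≡ false → IsIDS G₂ Q
    restricted₂ _ Q _ ids = Equivalence.from (IsIDS⇔IsIDSᵇ-lookup G₂ Q) ∘ Side₂.restricted-IDS ids

    forced₁ : ∀ P Q R → IsIDSᵇ edge (member P Q R) → lookup R hub₁ ≡ true → P ≡ X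
    forced₁ P _ _ ids R∋hub₁ = lookup-extensionality {P = P} (Side₁.forced ids R∋hub₁ (proj₁ X-idsᵇ))

    forced₂ : ∀ P Q R → IsIDSᵇ edge (member P Q R) → lookup R hub₂ ≡ true → Q ≡ Y
    forced₂ _ Q _ ids R∋hub₂ = lookup-extensionality {P = Q} (Side₂.forced ids R∋hub₂ (proj₁ Y-idsᵇ))

    shapeᵇ : ∀ P Q R → IsIDSᵇ edge (member P Q R) → Shape (P ++ (Q ++ R))
    shapeᵇ P Q R ids
      with gadget-shape R (λ g h → proj₁ ids (inj₂ (inj₂ g)) (inj₂ (inj₂ h))) (twin-dominated ids)
    ... | inj₁ refl with refl ← forced₂ P Q ⁅ hub₂ ⁆ ids refl =
      withHub₂ (restricted₁ P Y ⁅ hub₂ ⁆ ids refl)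
    ... | inj₂ (inj₁ refl) with refl ← forced₁ P Q ⁅ hub₁ ⁆ ids refl =
      withHub₁ (restricted₂ X Q ⁅ hub₁ ⁆ ids refl)
    ... | inj₂ (inj₂ refl) =
      withTwins (restricted₁ P Q twins ids refl) (restricted₂ P Q twins ids refl)

    shape : ∀ D → IsIDS G D → Shape D
    shape D D-ids
      with (P , QR , refl) ← Vec.splitAt (n G₁) D
      with (Q , R , refl) ← Vec.splitAt (n G₂) QR =
      shapeᵇ P Q R (Equivalence.to (IsIDS⇔member P Q R) D-ids)

    lower-bound : ∀ D → IsIDS G D → ∣ X ∣ + (∣ Y ∣ + 1) ≤ ∣ D ∣
    lower-bound D D-ids with shape D D-ids
    ... | withHub₂ {P} P-ids = ≤-trans (+-monoˡ-≤ (∣ Y ∣ + 1) (proj₂ X-iset P P-ids))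
                                       (≤-reflexive (sym (∣P++Q++R∣ P Y ⁅ hub₂ ⁆)))
    ... | withHub₁ {Q} Q-ids = ≤-trans (+-monoʳ-≤ ∣ X ∣ (+-monoˡ-≤ 1 (proj₂ Y-iset Q Q-ids)))
                                       (≤-reflexive (sym (∣P++Q++R∣ X Q ⁅ hub₁ ⁆)))
    ... | withTwins {P} {Q} P-ids Q-ids =
      ≤-trans (+-mono-≤ (proj₂ X-iset P P-ids) (+-mono-≤ (proj₂ Y-iset Q Q-ids) (s≤s z≤n)))
              (≤-reflexive (sym (∣P++Q++R∣ P Q twins)))

    A-ISet : ∀ {P} → IsISet G₁ P → IsISet G (A P)
    A-ISet {P} (P-ids , P-min) = A-IDS P-ids , λ T T-ids → begin
      ∣ A P ∣                 ≡⟨ ∣P++Q++R∣ P Y ⁅ hub₂ ⁆ ⟩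
      ∣ P ∣ + (∣ Y ∣ + 1)     ≤⟨ +-monoˡ-≤ (∣ Y ∣ + 1) (P-min X X-ids) ⟩
      ∣ X ∣ + (∣ Y ∣ + 1)     ≤⟨ lower-bound T T-ids ⟩
      ∣ T ∣                   ∎
      where open ≤-Reasoning

    B-ISet : ∀ {Q} → IsISet G₂ Q → IsISet G (B Q)
    B-ISet {Q} (Q-ids , Q-min) = B-IDS Q-ids , λ T T-ids → begin
      ∣ B Q ∣                 ≡⟨ ∣P++Q++R∣ X Q ⁅ hub₁ ⁆ ⟩
      ∣ X ∣ + (∣ Q ∣ + 1)     ≤⟨ +-monoʳ-≤ ∣ X ∣ (+-monoˡ-≤ 1 (Q-min Y Y-ids)) ⟩
      ∣ X ∣ + (∣ Y ∣ + 1)     ≤⟨ lower-bound T T-ids ⟩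
      ∣ T ∣                   ∎
      where open ≤-Reasoning

    ISet-cases : ∀ D → IsISet G D → (∃ λ P → IsISet G₁ P × A P ≡ D) ⊎ (∃ λ Q → IsISet G₂ Q × B Q ≡ D)
    ISet-cases D (D-ids , D-min) with shape D D-ids
    ... | withHub₂ {P} P-ids = inj₁ (P , (P-ids , λ T T-ids → ≤-trans P≤X (proj₂ X-iset T T-ids)) , refl)
      where
      P≤X : ∣ P ∣ ≤ ∣ X ∣
      P≤X = +-cancelʳ-≤ (∣ Y ∣ + 1) _ _ (subst₂ _≤_ (∣P++Q++R∣ P Y ⁅ hub₂ ⁆) (∣P++Q++R∣ X Y ⁅ hub₂ ⁆)
                                           (D-min (A X) (A-IDS X-ids)))
    ... | withHub₁ {Q} Q-ids = inj₂ (Q , (Q-ids , λ T T-ids → ≤-trans Q≤Y (proj₂ Y-iset T T-ids)) , refl)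
      where
      Q≤Y : ∣ Q ∣ ≤ ∣ Y ∣
      Q≤Y = +-cancelʳ-≤ 1 _ _ (+-cancelˡ-≤ ∣ X ∣ _ _
              (subst₂ _≤_ (∣P++Q++R∣ X Q ⁅ hub₁ ⁆) (∣P++Q++R∣ X Y ⁅ hub₁ ⁆) (D-min (B Y) (B-IDS Y-ids))))
    ... | withTwins {P} {Q} P-ids Q-ids = ⊥-elim (2≰1 (+-cancelˡ-≤ ∣ Y ∣ _ _ (+-cancelˡ-≤ ∣ X ∣ _ _ (begin
      ∣ X ∣ + (∣ Y ∣ + 2)     ≤⟨ +-mono-≤ (proj₂ X-iset P P-ids) (+-monoˡ-≤ 2 (proj₂ Y-iset Q Q-ids)) ⟩
      ∣ P ∣ + (∣ Q ∣ + 2)     ≡⟨ sym (∣P++Q++R∣ P Q twins) ⟩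
      ∣ P ++ (Q ++ twins) ∣   ≤⟨ D-min (A X) (A-IDS X-ids) ⟩
      ∣ A X ∣                 ≡⟨ ∣P++Q++R∣ X Y ⁅ hub₂ ⁆ ⟩
      ∣ X ∣ + (∣ Y ∣ + 1)     ∎))))
      where
      open ≤-Reasoning
      2≰1 : ¬ 2 ≤ 1
      2≰1 (s≤s ())

-- Realising H_xy

⌊≟⌋∧⌊≟⌋⇔≡×≡ : (s x : Fin m) (t y : Fin k) → (⌊ s ≟ x ⌋ ∧ ⌊ t ≟ y ⌋ ≡ true) ⇔ (s ≡ x × t ≡ y)
⌊≟⌋∧⌊≟⌋⇔≡×≡ s x t y with s ≟ x | t ≟ y
... | yes s≡x | yes t≡y = mk⇔ (λ _ → s≡x , t≡y) (λ _ → refl)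
... | yes _ | no t≢y = mk⇔ (λ ()) (⊥-elim ∘ t≢y ∘ proj₂)
... | no s≢x | _ = mk⇔ (λ ()) (⊥-elim ∘ s≢x ∘ proj₁)

joinEdge-iso : {H₁ H₂ G₁ G₂ : Graph} (iso₁ : IsoToIGraph H₁ G₁) (iso₂ : IsoToIGraph H₂ G₂)
               (x : Fin (n H₁)) (y : Fin (n H₂)) →
               IsoToIGraph (joinEdge H₁ H₂ x y) (Construction.G G₁ G₂ (proj₁ iso₁ x) (proj₁ iso₂ y))
joinEdge-iso {H₁} {H₂} {G₁} {G₂} (f₁ , f₁-iset , f₁-inj , f₁-onto , f₁-adj)
                                  (f₂ , f₂-iset , f₂-inj , f₂-onto , f₂-adj) x y =
  f , f-iset , f-inj , f-onto , f-adj
  where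
  open Construction G₁ G₂ (f₁ x) (f₂ y)
  open ISets (f₁-iset x) (f₂-iset y)

  f⊎ : Fin (n H₁) ⊎ Fin (n H₂) → Subset N
  f⊎ = [ A ∘ f₁ , B ∘ f₂ ]′

  f : Fin (n H₁ + n H₂) → Subset N
  f a = f⊎ (splitAt (n H₁) a)

  f-iset : ∀ a → IsISet G (f a)
  f-iset a with splitAt (n H₁) a
  ... | inj₁ s = A-ISet (f₁-iset s)
  ... | inj₂ t = B-ISet (f₂-iset t)

  f⊎-injective : ∀ e e′ → f⊎ e ≡ f⊎ e′ → e ≡ e′
  f⊎-injective (inj₁ s) (inj₁ s′) eq = cong inj₁ (f₁-inj (A-injective {f₁ s} eq))
  f⊎-injective (inj₂ t) (inj₂ t′) eq = cong inj₂ (f₂-inj (B-injective {f₂ t} eq))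
  f⊎-injective (inj₁ s) (inj₂ t) eq = ⊥-elim (A≢B {f₁ s} eq)
  f⊎-injective (inj₂ t) (inj₁ s) eq = ⊥-elim (A≢B {f₁ s} (sym eq))

  f-inj : Injective _≡_ _≡_ f
  f-inj {a} {b} eq = begin
    a                                       ≡⟨ join-splitAt (n H₁) (n H₂) a ⟨
    join (n H₁) (n H₂) (splitAt (n H₁) a)  ≡⟨ cong (join (n H₁) (n H₂)) splitAt-a≡splitAt-b ⟩
    join (n H₁) (n H₂) (splitAt (n H₁) b)  ≡⟨ join-splitAt (n H₁) (n H₂) b ⟩
    b                                       ∎
    where
    open ≡-Reasoning
    splitAt-a≡splitAt-b : splitAt (n H₁) a ≡ splitAt (n H₁) b
    splitAt-a≡splitAt-b = f⊎-injective (splitAt (n H₁) a) (splitAt (n H₁) b) eq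

  f-onto : ∀ D → IsISet G D → ∃ λ a → f a ≡ D
  f-onto D D-iset with ISet-cases D D-iset
  ... | inj₁ (P , P-iset , refl) with (s , refl) ← f₁-onto P P-iset =
    s ↑ˡ n H₂ , cong f⊎ (splitAt-↑ˡ (n H₁) s (n H₂))
  ... | inj₂ (Q , Q-iset , refl) with (t , refl) ← f₂-onto Q Q-iset =
    n H₁ ↑ʳ t , cong f⊎ (splitAt-↑ʳ (n H₁) (n H₂) t)

  new-edge⇔ : ∀ s t → (⌊ s ≟ x ⌋ ∧ ⌊ t ≟ y ⌋ ≡ true) ⇔ (f₁ s ≡ f₁ x × f₂ t ≡ f₂ y)
  new-edge⇔ s t = ⇔-trans (⌊≟⌋∧⌊≟⌋⇔≡×≡ s x t y)
                          (mk⇔ (Product.map (cong f₁) (cong f₂)) (Product.map f₁-inj f₂-inj))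

  f-adj : ∀ a b → (adj (joinEdge H₁ H₂ x y) a b ≡ true) ⇔ IAdj G (f a) (f b)
  f-adj a b with splitAt (n H₁) a | splitAt (n H₁) b
  ... | inj₁ s | inj₁ s′ = ⇔-trans (f₁-adj s s′) A-IAdj⇔
  ... | inj₂ t | inj₂ t′ = ⇔-trans (f₂-adj t t′) B-IAdj⇔
  ... | inj₁ s | inj₂ t = ⇔-trans (new-edge⇔ s t) (⇔-sym A-B-IAdj⇔)
  ... | inj₂ t | inj₁ s = ⇔-trans (new-edge⇔ s t) (⇔-sym B-A-IAdj⇔)

proposition5p7 : (H₁ H₂ : Graph) → IsSimple H₁ → IsSimple H₂ →
                 IGraphRealizable H₁ → IGraphRealizable H₂ →
                 (x : Fin (n H₁)) (y : Fin (n H₂)) →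
                 IGraphRealizable (joinEdge H₁ H₂ x y)
proposition5p7 H₁ H₂ _ _ (G₁ , G₁-simple , iso₁) (G₂ , G₂-simple , iso₂) x y =
  Construction.G G₁ G₂ _ _ ,
  Construction.G-simple G₁ G₂ _ _ G₁-simple G₂-simple ,
  joinEdge-iso iso₁ iso₂ x y
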